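{- Let $G$ be an $n$-vertex planar graph with diameter $D_G$, let $f(x)=\lceil 2\sqrt{2}\sqrt{x}\,\rceil$ and let $k=C_f(n)=O(\sqrt{n})$, where $C_f(n)=f(n)+\sum_{i=0}^{\lceil\log_{3/2}n\rceil+1} f\big(\lfloor(2/3)^i n\rfloor\big)$. Then the STT algorithm with $k$ cops (using the Lipton–Tarjan separation algorithm) captures the robber on $G$ within $O(D_G\cdot\sqrt{n})$ rounds; in particular $\mathsf{capt}_k(G)=O(D_G\cdot\sqrt n)$.
   Context: Zero-visibility Cops and Robbers on $G$: cops choose starting vertices, then the robber; in each round each cop stays or moves to an adjacent vertex, then the robber does likewise; the robber is invisible to the cops; capture occurs when a cop occupies the robber's vertex. $\mathsf{capt}_k(G)$ denotes the minimum, over cop strategies with $k$ cops, of the maximum number of rounds until capture. The Lipton–Tarjan separation algorithm partitions the vertex set of any $m$-vertex planar graph in $O(m)$ time into $A,B,S$ with no edge between $A$ and $B$, $|A|,|B|\le\frac23 m$ and $|S|\le 2\sqrt2\sqrt m$; planar graphs form a hereditary class. STT on an $n$-vertex $G$, using this separation algorithm $\mathcal{S}$: it keeps Stack-B of pairs (vertex set, binary string index) and Stack-C of pairs (separator, index). Scheduler: push $(V(G),\varepsilon)$ on Stack-B, Stack-C empty. While Stack-B is nonempty: pop $(U,w)$; let $p$ be $w$ without its last character; if Stack-C is nonempty then, while $p$ differs from the index of the top of Stack-C, pop $(S,w')$ from Stack-C and remove the cops from $S$; then call Separate$(G[U],w,n)$. Separate$(H,w,n)$: if $|V(H)|\le f(n)$,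 place cops on all vertices of $H$ and then remove them; otherwise compute $(A,B,C)=\mathcal{S}(H)$, place cops on all vertices of $C$, push $(C,w)$ onto Stack-C, then push $(B,w\cdot0)$ and $(A,w\cdot1)$ onto Stack-B. Placements are realised by walking cops along edges to their targets. -}

module Defs where

open import Data.Nat using (ℕ; zero; suc; _+_; _*_; _^_; _≤_; _<_; _≤ᵇ_; _/_)
open import Data.Nat.Properties using (m^n≢0)
open import Data.Bool using (Bool; true; false; if_then_else_; T)
open import Data.Fin using (Fin)
open import Data.Fin.Subset using (Subset; _∈_; _∪_; _∩_; _─_; ∣_∣; ⊥; ⊤)
open import Data.List using (List; []; _∷_; _++_; map; upTo)
open import Data.Nat.ListAction using (sum)
open import Data.Product using (Σ; ∃; ∃-syntax; _×_; _,_)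
open import Data.Sum using (_⊎_)
open import Data.Integer as ℤ using (ℤ)
open import Relation.Binary.PropositionalEquality using (_≡_)
open import Relation.Nullary using (¬_; yes; no)
open import Data.Nat using (_≤?_)

firstFrom : ℕ → (ℕ → Bool) → ℕ → ℕ
firstFrom zero    p m = m
firstFrom (suc k) p m = if p m then m else firstFrom k p (suc m)

-- ⌈ √ x ⌉ : least m with x ≤ m²  (this is always ≤ x)
ceilSqrt : ℕ → ℕ
ceilSqrt x = firstFrom x (λ m → x ≤ᵇ m * m) 0

-- f(x) = ⌈ 2√2 √x ⌉ = ⌈ √(8x) ⌉
f : ℕ → ℕ
f x = ceilSqrt (8 * x)

-- ⌈ log_{3/2} n ⌉ for n ≥ 1 : least L with n ≤ (3/2)^L, i.e. n·2^L ≤ 3^L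
-- (always ≤ n, since (3/2)^n ≥ n)
ceilLog32 : ℕ → ℕ
ceilLog32 n = firstFrom n (λ L → n * 2 ^ L ≤ᵇ 3 ^ L) 0

floorTwoThirdsPow : ℕ → ℕ → ℕ
floorTwoThirdsPow i n = _/_ (2 ^ i * n) (3 ^ i) {{m^n≢0 3 i}}

C-f : ℕ → ℕ
C-f n = f n + sum (map (λ i → f (floorTwoThirdsPow i n)) (upTo (ceilLog32 n + 2)))

record Graph (n : ℕ) : Set where
  field
    adj     : Fin n → Fin n → Bool
    sym     : ∀ u v → adj u v ≡ adj v u
    irrefl  : ∀ u → adj u u ≡ false

open Graph public

Adj : ∀ {n} → Graph n → Fin n → Fin n → Set
Adj G u v = T (adj G u v)

Point : Set
Point = ℤ × ℤ

orient : Point → Point → Point → ℤ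
orient (px , py) (qx , qy) (rx , ry) =
  (qx ℤ.- px) ℤ.* (ry ℤ.- py) ℤ.- (qy ℤ.- py) ℤ.* (rx ℤ.- px)

OnSegment : Point → Point → Point → Set
OnSegment p@(px , py) q@(qx , qy) r@(rx , ry) =
  orient q r p ≡ ℤ.0ℤ ×
  ((qx ℤ.⊓ rx) ℤ.≤ px × px ℤ.≤ (qx ℤ.⊔ rx)) ×
  ((qy ℤ.⊓ ry) ℤ.≤ py × py ℤ.≤ (qy ℤ.⊔ ry))

ProperCross : Point → Point → Point → Point → Set
ProperCross a b c d =
  orient a b c ℤ.* orient a b d ℤ.< ℤ.0ℤ ×
  orient c d a ℤ.* orient c d b ℤ.< ℤ.0ℤ

record StraightLineEmbedding {n} (G : Graph n) : Set where
  field
    pos        : Fin n → Point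
    injective  : ∀ u v → pos u ≡ pos v → u ≡ v
    noVertexOnEdge : ∀ v a b → Adj G a b → ¬ (v ≡ a) → ¬ (v ≡ b) →
                     ¬ OnSegment (pos v) (pos a) (pos b)
    noCrossing : ∀ a b c d → Adj G a b → Adj G c d →
                 ¬ (a ≡ c) → ¬ (a ≡ d) → ¬ (b ≡ c) → ¬ (b ≡ d) →
                 ¬ ProperCross (pos a) (pos b) (pos c) (pos d)

Planar : ∀ {n} → Graph n → Set
Planar G = StraightLineEmbedding G

data WithinDist {n} (G : Graph n) : ℕ → Fin n → Fin n → Set where
  here  : ∀ {t u} → WithinDist G t u u
  step  : ∀ {t u w v} → Adj G u w → WithinDist G t w v →
          WithinDist G (suc t) u v

-- D is the diameter of G (in particular G is connected)
IsDiameter : ∀ {n} → Graph n → ℕ → Set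
IsDiameter G D =
  (∀ u v → WithinDist G D u v) ×
  (∀ D' → (∀ u v → WithinDist G D' u v) → D ≤ D')

StayOrMove : ∀ {n} → Graph n → Fin n → Fin n → Set
StayOrMove G u v = u ≡ v ⊎ Adj G u v

-- a (deterministic) strategy for k cops: positions at each time
-- (time 0 = chosen starting vertices; time t = after the cops' move of round t)
record CopStrategy {n} (G : Graph n) (k : ℕ) : Set where
  field
    cop   : ℕ → Fin k → Fin n
    legal : ∀ t i → StayOrMove G (cop t i) (cop (suc t) i)

open CopStrategy public

-- a robber walk: position at time 0 and after its move in each round
record RobberWalk {n} (G : Graph n) : Set where
  field
    rob   : ℕ → Fin n
    legal : ∀ t → StayOrMove G (rob t) (rob (suc t))

open RobberWalk public

-- capture happens within T rounds: either at time t ≤ T a cop is on the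
-- robber's vertex (start, or after the robber's move), or in round t+1 ≤ T
-- a cop moves onto the robber's vertex
CaughtWithin : ∀ {n k} {G : Graph n} → CopStrategy G k → RobberWalk G → ℕ → Set
CaughtWithin σ r T =
  ∃[ t ] (t ≤ T × ∃[ i ] (cop σ t i ≡ rob r t ⊎
                          (suc t ≤ T × cop σ (suc t) i ≡ rob r t)))

-- the strategy captures every (invisible) robber within T rounds
CapturesWithin : ∀ {n k} {G : Graph n} → CopStrategy G k → ℕ → Set
CapturesWithin {G = G} σ T = ∀ (r : RobberWalk G) → CaughtWithin σ r T

CaptLe : ∀ {n} → Graph n → ℕ → ℕ → Set
CaptLe G k T = Σ (CopStrategy G k) λ σ → CapturesWithin σ T

-- Separation algorithms (on induced subgraphs G[U], U ⊆ V(G))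

Separator : ℕ → Set
Separator n = Subset n → Subset n × Subset n × Subset n

IsSeparation : ∀ {n} → Graph n → Subset n → Subset n × Subset n × Subset n → Set
IsSeparation G U (A , B , C) =
  (A ∪ B) ∪ C ≡ U ×
  A ∩ B ≡ ⊥ × A ∩ C ≡ ⊥ × B ∩ C ≡ ⊥ ×
  (∀ a b → a ∈ A → b ∈ B → ¬ Adj G a b) ×
  3 * ∣ A ∣ ≤ 2 * ∣ U ∣ ×
  3 * ∣ B ∣ ≤ 2 * ∣ U ∣ ×
  ∣ C ∣ * ∣ C ∣ ≤ 8 * ∣ U ∣          -- |C| ≤ 2√2 √|U|

IsLTSeparator : ∀ {n} → Graph n → Separator n → Set
IsLTSeparator G 𝒮 = ∀ U → IsSeparation G U (𝒮 U)

-- The STT schedule: the sequence of "place cops on X" / "remove cops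
-- from X" operations produced by the scheduler (depth-first order:
-- A-part before B-part, as Stack-B pops (A, w1) before (B, w0)).

data Op (n : ℕ) : Set where
  place  : Subset n → Op n
  remove : Subset n → Op n

-- fuel bounds the recursion depth (n+1 levels always suffice, since the
-- parts shrink strictly); threshold = f(n) of the original graph
sttOps : ∀ {n} → Separator n → (threshold fuel : ℕ) → Subset n → List (Op n)
sttOps 𝒮 thr zero    U = place U ∷ remove U ∷ []
sttOps 𝒮 thr (suc k) U with ∣ U ∣ ≤? thr
... | yes _ = place U ∷ remove U ∷ []
... | no  _ with 𝒮 U
...   | (A , B , C) =
  place C ∷ (sttOps 𝒮 thr k A ++ (sttOps 𝒮 thr k B ++ (remove C ∷ [])))

STT : ∀ {n} → Separator n → List (Op n)
STT {n} 𝒮 = sttOps 𝒮 (f n) (suc n) ⊤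

Occupied : ∀ {n k} {G : Graph n} → CopStrategy G k → ℕ → Subset n → Set
Occupied σ s S = ∀ x → x ∈ S → ∃[ i ] (cop σ s i ≡ x)

-- Runs σ D held t ops t' : starting at time t with the vertex set `held`
-- guarded, the cop strategy σ carries out the operations `ops`, finishing
-- at time t'.
data Runs {n k} {G : Graph n} (σ : CopStrategy G k) (D : ℕ) :
          Subset n → ℕ → List (Op n) → ℕ → Set where
  done   : ∀ {held t} → Runs σ D held t [] t
  place  : ∀ {held t X ops t'} (d : ℕ) → d ≤ D →
           (∀ s → t ≤ s → s ≤ t + d → Occupied σ s held) →
           Occupied σ (t + d) X →
           Runs σ D (held ∪ X) (t + d) ops t' →
           Runs σ D held t (place X ∷ ops) t'
  remove : ∀ {held t X ops t'} → Runs σ D (held ─ X) t ops t' →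
           Runs σ D held t (remove X ∷ ops) t'

RealisesSTT : ∀ {n k} {G : Graph n} → CopStrategy G k → ℕ → Separator n → ℕ → Set
RealisesSTT σ D 𝒮 t' = Runs σ D ⊥ 0 (STT 𝒮) t'

{-# OPTIONS --safe #-}
-- A part of the recursion at depth j has at most (2/3)^j n vertices, so its separator has at most
-- f(⌊(2/3)^j n⌋) vertices. The cops stand on the separators of the current root-to-node path and on
-- at most one leaf (at most f(n) vertices), and parts below depth ⌈log_{3/2} n⌉ are leaves, so
-- C_f(n) cops suffice. Since (2/3)^4 ≤ 1/4, the terms of C_f(n) taken four at a time are bounded by
-- 6⌊⌈√n⌉/2^j⌋, whence C_f(n) ≤ 51⌈√n⌉.
--
-- Every placement is realised by letting each cop walk for D rounds to its new vertex; cops on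
-- stacked separators stay put. An internal node of the recursion has more than f(n) vertices and
-- its children at most two thirds of them, so (#placements + 1)·f(n) ≤ max(2f(n), 6|U|) for every
-- part U; hence there are at most 6⌈√n⌉ placements and STT ends within 6D⌈√n⌉ rounds.
--
-- While a part U is processed, the vertices through which the robber could enter U stay occupied.
-- After the separator C is placed and the part A processed, the robber is caught or outside A, and
-- it cannot re-enter A while C and the guards of U are occupied; after B is processed the same holds
-- for B. So the robber ends caught or outside U, and for U = V(G) it is caught.
module Submission where

open import Defs renaming (sym to adj-sym)
open import Data.Bool using (Bool; true; false; T)
open import Data.List using (List; []; _∷_; _++_; _∷ʳ_; map; length; applyUpTo; upTo)
open import Data.List.Properties
  using (applyUpTo-∷ʳ; map-upTo; ++-assoc; ++-identityʳ; length-map; length-++; length-++-≤ˡ; map-++)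
open import Data.List.Membership.Propositional using () renaming (_∈_ to _∈ₗ_)
open import Data.List.Membership.Propositional.Properties using (∈-map⁺; ∈-map⁻; ∈-++⁺ˡ; ∈-++⁺ʳ; ∈-++⁻)
open import Data.List.Relation.Unary.All using (All; []; _∷_)
open import Data.List.Relation.Unary.All.Properties using (++⁺; ++⁻)
import Data.List.Relation.Unary.Any as Any
open import Data.Nat
open import Data.Nat.DivMod using (m≡m%n+[m/n]*n; m%n<n; m/n*n≤m; m*n/n≡m; /-monoˡ-≤)
open import Data.Nat.ListAction using (sum)
open import Data.Nat.ListAction.Properties using (sum-++)
open import Data.Nat.Properties
open import Data.Nat.Tactic.RingSolver using (solve-∀)
open import Data.Fin as Fin using (Fin; toℕ; fromℕ<)
open import Data.Fin.Properties using (toℕ-fromℕ<)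
open import Data.Fin.Subset using (Subset; _∈_; _∉_; _⊆_; _∪_; _∩_; _─_; ∣_∣; ⊤; ⊥; inside; outside)
open import Data.Fin.Subset.Properties
  using (_∈?_; x∈p∪q⁺; x∈p∪q⁻; x∈p∩q⁺; ∉⊥; ∈⊤; x∈p∧x∉q⇒x∈p─q; p─q⊆p; ∣⊥∣≡0; ∣p∣≤∣p∪q∣; ∣⊤∣≡n)
open import Data.Product using (Σ; ∃-syntax; _×_; _,_; proj₁; proj₂)
open import Data.Sum using (_⊎_; inj₁; inj₂)
open import Data.Vec using ([]; _∷_; here; there)
open import Data.Unit using (tt)
open import Function using (_∘_; id)
open import Relation.Binary.PropositionalEquality
open import Relation.Nullary using (¬_; yes; no; contradiction)

open ≤-Reasoning

-- Ceiling square roots, powers of 3/2 and the size of C_f(n)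

firstFrom-least : ∀ fuel (p : ℕ → Bool) {m j} → m ≤ j → T (p j) → firstFrom fuel p m ≤ j
firstFrom-least zero       p m≤j _  = m≤j
firstFrom-least (suc fuel) p {m} {j} m≤j pj with p m in pm
... | true  = m≤j
... | false = firstFrom-least fuel p (≤∧≢⇒< m≤j m≢j) pj
  where
  m≢j : m ≢ j
  m≢j refl = subst T pm pj

firstFrom-sound : ∀ fuel (p : ℕ → Bool) m → T (p (m + fuel)) → T (p (firstFrom fuel p m))
firstFrom-sound zero       p m pfin = subst (T ∘ p) (+-identityʳ m) pfin
firstFrom-sound (suc fuel) p m pfin with p m in pm
... | true  = subst T (sym pm) tt
... | false = firstFrom-sound fuel p (suc m) (subst (T ∘ p) (+-suc m fuel) pfin)

m≤m*m : ∀ m → m ≤ m * m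
m≤m*m zero    = z≤n
m≤m*m (suc m) = m≤m*n (suc m) (suc m)

m*m≤n*n⇒m≤n : ∀ {m n} → m * m ≤ n * n → m ≤ n
m*m≤n*n⇒m≤n {m} {n} mm≤nn with m ≤? n
... | yes m≤n = m≤n
... | no  m≰n = contradiction mm≤nn (<⇒≱ (*-mono-< (≰⇒> m≰n) (≰⇒> m≰n)))

ceilSqrt-least : ∀ x {k} → x ≤ k * k → ceilSqrt x ≤ k
ceilSqrt-least x x≤k² = firstFrom-least x (λ m → x ≤ᵇ m * m) z≤n (≤⇒≤ᵇ x≤k²)

≤ceilSqrt² : ∀ x → x ≤ ceilSqrt x * ceilSqrt x
≤ceilSqrt² x =
  ≤ᵇ⇒≤ x _ (firstFrom-sound x (λ m → x ≤ᵇ m * m) 0 (≤⇒≤ᵇ (m≤m*m x)))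

≤ceilSqrt : ∀ {a x} → a * a ≤ x → a ≤ ceilSqrt x
≤ceilSqrt {x = x} a²≤x = m*m≤n*n⇒m≤n (≤-trans a²≤x (≤ceilSqrt² x))

ceilSqrt-pos : ∀ {x} → 0 < x → 0 < ceilSqrt x
ceilSqrt-pos {x} 0<x with ceilSqrt x | ≤ceilSqrt² x
... | zero  | x≤0 = contradiction x≤0 (<⇒≱ 0<x)
... | suc _ | _   = z<s

ceilSqrt≤f : ∀ x → ceilSqrt x ≤ f x
ceilSqrt≤f x = ceilSqrt-least x (≤-trans (m≤m+n x (7 * x)) (≤ceilSqrt² (8 * x)))

f≤3*ceilSqrt : ∀ x → f x ≤ 3 * ceilSqrt x
f≤3*ceilSqrt x = ceilSqrt-least (8 * x) (begin
  8 * x                        ≤⟨ m≤n+m (8 * x) x ⟩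
  9 * x                        ≤⟨ *-monoʳ-≤ 9 (≤ceilSqrt² x) ⟩
  9 * (c * c)                  ≡⟨ nine-squares c ⟩
  3 * c * (3 * c)              ∎)
  where
  c = ceilSqrt x
  nine-squares : ∀ c → 9 * (c * c) ≡ 3 * c * (3 * c)
  nine-squares = solve-∀

<[1+h]²⇒ceilSqrt≤2h : ∀ {y} h → y < suc h * suc h → ceilSqrt y ≤ 2 * h
<[1+h]²⇒ceilSqrt≤2h zero    (s≤s z≤n) = z≤n
<[1+h]²⇒ceilSqrt≤2h {y} (suc h) y<[2+h]² = ceilSqrt-least y (begin
  y                                 ≤⟨ <⇒≤ y<[2+h]² ⟩
  suc (suc h) * suc (suc h)         ≤⟨ *-mono-≤ 2+h≤2[1+h] 2+h≤2[1+h] ⟩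
  2 * suc h * (2 * suc h)           ∎)
  where
  2+h≤2[1+h] : suc (suc h) ≤ 2 * suc h
  2+h≤2[1+h] = s≤s (≤-trans (m≤n+m (suc h) h) (≤-reflexive (cong (h +_) (sym (+-identityʳ (suc h))))))

<-of-scaled-squares : ∀ {y b m h} → y * (b * b) ≤ m * m → m < suc h * b → y < suc h * suc h
<-of-scaled-squares {y} {b} {m} {h} scaled m<[1+h]b = *-cancelʳ-< (b * b) y (suc h * suc h) (begin-strict
  y * (b * b)                       ≤⟨ scaled ⟩
  m * m                             <⟨ *-mono-< m<[1+h]b m<[1+h]b ⟩
  suc h * b * (suc h * b)           ≡⟨ swap-middle (suc h) b ⟩
  suc h * suc h * (b * b)           ∎)
  where
  swap-middle : ∀ a b → a * b * (a * b) ≡ a * a * (b * b)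
  swap-middle = solve-∀

n*2^n≤3^n : ∀ n → n * 2 ^ n ≤ 3 ^ n
n*2^n≤3^n 0 = z≤n
n*2^n≤3^n 1 = m≤m+n 2 1
n*2^n≤3^n 2 = m≤m+n 8 1
n*2^n≤3^n (suc n@(suc (suc _))) = begin
  suc n * (2 * 2 ^ n)               ≡⟨ expand n (2 ^ n) ⟩
  (2 * n + 2) * 2 ^ n               ≤⟨ *-monoˡ-≤ (2 ^ n) (+-monoʳ-≤ (2 * n) (s≤s (s≤s z≤n))) ⟩
  (2 * n + n) * 2 ^ n               ≡⟨ regroup n (2 ^ n) ⟩
  3 * (n * 2 ^ n)                   ≤⟨ *-monoʳ-≤ 3 (n*2^n≤3^n n) ⟩
  3 * 3 ^ n                         ∎
  where
  expand : ∀ a b → suc a * (2 * b) ≡ (2 * a + 2) * b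
  expand = solve-∀
  regroup : ∀ a b → (2 * a + a) * b ≡ 3 * (a * b)
  regroup = solve-∀

*2^≤3^-mono : ∀ {a i j} → a * 2 ^ i ≤ 3 ^ i → i ≤ j → a * 2 ^ j ≤ 3 ^ j
*2^≤3^-mono {a} {i} a2^i≤3^i i≤j = go (≤⇒≤′ i≤j)
  where
  go : ∀ {j} → i ≤′ j → a * 2 ^ j ≤ 3 ^ j
  go ≤′-refl              = a2^i≤3^i
  go (≤′-step {j} i≤′j) = begin
    a * (2 * 2 ^ j)                 ≡⟨ x*[2*y]≡2*[x*y] a (2 ^ j) ⟩
    2 * (a * 2 ^ j)                 ≤⟨ *-monoʳ-≤ 2 (go i≤′j) ⟩
    2 * 3 ^ j                       ≤⟨ *-monoˡ-≤ (3 ^ j) (n≤1+n 2) ⟩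
    3 * 3 ^ j                       ∎
    where
    x*[2*y]≡2*[x*y] : ∀ x y → x * (2 * y) ≡ 2 * (x * y)
    x*[2*y]≡2*[x*y] = solve-∀

ceilLog32-≤ : ∀ n → ceilLog32 n ≤ n
ceilLog32-≤ n = firstFrom-least n (λ L → n * 2 ^ L ≤ᵇ 3 ^ L) z≤n (≤⇒≤ᵇ (n*2^n≤3^n n))

ceilLog32-spec : ∀ n → n * 2 ^ ceilLog32 n ≤ 3 ^ ceilLog32 n
ceilLog32-spec n =
  ≤ᵇ⇒≤ _ _ (firstFrom-sound n (λ L → n * 2 ^ L ≤ᵇ 3 ^ L) 0 (≤⇒≤ᵇ (n*2^n≤3^n n)))

floorTwoThirdsPow-spec : ∀ i n → floorTwoThirdsPow i n * 3 ^ i ≤ 2 ^ i * n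
floorTwoThirdsPow-spec i n = m/n*n≤m (2 ^ i * n) (3 ^ i) {{m^n≢0 3 i}}

⌊_/2^_⌋ : ℕ → ℕ → ℕ
⌊ m /2^ zero  ⌋ = m
⌊ m /2^ suc j ⌋ = ⌊ m / 2 /2^ j ⌋

m<[1+⌊m/2^j⌋]*2^j : ∀ m j → m < suc ⌊ m /2^ j ⌋ * 2 ^ j
m<[1+⌊m/2^j⌋]*2^j m zero    = ≤-reflexive (sym (*-identityʳ (suc m)))
m<[1+⌊m/2^j⌋]*2^j m (suc j) = begin-strict
  m                                 ≡⟨ m≡m%n+[m/n]*n m 2 ⟩
  m % 2 + m / 2 * 2                 <⟨ +-monoˡ-< (m / 2 * 2) (m%n<n m 2) ⟩
  suc (m / 2) * 2                   ≤⟨ *-monoˡ-≤ 2 (m<[1+⌊m/2^j⌋]*2^j (m / 2) j) ⟩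
  suc h * 2 ^ j * 2                 ≡⟨ x*y*2≡x*[2*y] (suc h) (2 ^ j) ⟩
  suc h * (2 * 2 ^ j)               ∎
  where
  h = ⌊ m / 2 /2^ j ⌋
  x*y*2≡x*[2*y] : ∀ x y → x * y * 2 ≡ x * (2 * y)
  x*y*2≡x*[2*y] = solve-∀

sum-applyUpTo-suc : ∀ (g : ℕ → ℕ) N → sum (applyUpTo g (suc N)) ≡ sum (applyUpTo g N) + g N
sum-applyUpTo-suc g N = begin-equality
  sum (applyUpTo g (suc N))         ≡⟨ cong sum (applyUpTo-∷ʳ g N) ⟨
  sum (applyUpTo g N ∷ʳ g N)        ≡⟨ sum-++ (applyUpTo g N) (g N ∷ []) ⟩
  sum (applyUpTo g N) + (g N + 0)   ≡⟨ cong (sum (applyUpTo g N) +_) (+-identityʳ (g N)) ⟩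
  sum (applyUpTo g N) + g N         ∎

sum-applyUpTo-monoʳ : ∀ (g : ℕ → ℕ) {N N′} → N ≤ N′ → sum (applyUpTo g N) ≤ sum (applyUpTo g N′)
sum-applyUpTo-monoʳ g z≤n       = z≤n
sum-applyUpTo-monoʳ g (s≤s N≤N′) = +-monoʳ-≤ (g 0) (sum-applyUpTo-monoʳ (g ∘ suc) N≤N′)

sum-applyUpTo-*ˡ : ∀ c (g : ℕ → ℕ) N → sum (applyUpTo (λ i → c * g i) N) ≡ c * sum (applyUpTo g N)
sum-applyUpTo-*ˡ c g zero    = sym (*-zeroʳ c)
sum-applyUpTo-*ˡ c g (suc N) = begin-equality
  c * g 0 + sum (applyUpTo (λ i → c * g (suc i)) N) ≡⟨ cong (c * g 0 +_) (sum-applyUpTo-*ˡ c (g ∘ suc) N) ⟩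
  c * g 0 + c * sum (applyUpTo (g ∘ suc) N)         ≡⟨ *-distribˡ-+ c (g 0) _ ⟨
  c * (g 0 + sum (applyUpTo (g ∘ suc) N))           ∎

sum-applyUpTo-blocks : ∀ M (t u : ℕ → ℕ) → (∀ j r → r < 4 → t (j * 4 + r) ≤ u j) →
                       sum (applyUpTo t (M * 4)) ≤ 4 * sum (applyUpTo u M)
sum-applyUpTo-blocks zero    t u t≤u = z≤n
sum-applyUpTo-blocks (suc M) t u t≤u = begin
  t 0 + (t 1 + (t 2 + (t 3 + rest)))
    ≤⟨ +-mono-≤ (t≤u 0 0 (s≤s z≤n)) (+-mono-≤ (t≤u 0 1 (s≤s (s≤s z≤n)))
       (+-mono-≤ (t≤u 0 2 (s≤s (s≤s (s≤s z≤n)))) (+-mono-≤ (t≤u 0 3 ≤-refl)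
       (sum-applyUpTo-blocks M (λ i → t (4 + i)) (u ∘ suc) (t≤u ∘ suc))))) ⟩
  u 0 + (u 0 + (u 0 + (u 0 + 4 * sum (applyUpTo (u ∘ suc) M))))
    ≡⟨ four-copies (u 0) _ ⟩
  4 * (u 0 + sum (applyUpTo (u ∘ suc) M)) ∎
  where
  rest = sum (applyUpTo (λ i → t (4 + i)) (M * 4))
  four-copies : ∀ a b → a + (a + (a + (a + 4 * b))) ≡ 4 * (a + b)
  four-copies = solve-∀

sum-⌊m/2^j⌋≤2*m : ∀ M m → sum (applyUpTo (λ j → ⌊ m /2^ j ⌋) M) ≤ 2 * m
sum-⌊m/2^j⌋≤2*m zero    m = z≤n
sum-⌊m/2^j⌋≤2*m (suc M) m = begin
  m + sum (applyUpTo (λ j → ⌊ m / 2 /2^ j ⌋) M) ≤⟨ +-monoʳ-≤ m (sum-⌊m/2^j⌋≤2*m M (m / 2)) ⟩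
  m + 2 * (m / 2)                               ≤⟨ +-monoʳ-≤ m (≤-trans (≤-reflexive (*-comm 2 (m / 2))) (m/n*n≤m m 2)) ⟩
  m + m                                         ≡⟨ cong (m +_) (+-identityʳ m) ⟨
  2 * m                                         ∎

2^i*4^j≤3^i : ∀ j r → 2 ^ (j * 4 + r) * (2 ^ j * 2 ^ j) ≤ 3 ^ (j * 4 + r)
2^i*4^j≤3^i zero    r = ≤-trans (≤-reflexive (*-identityʳ (2 ^ r))) (^-monoˡ-≤ r (n≤1+n 2))
2^i*4^j≤3^i (suc j) r = begin
  2 * (2 * (2 * (2 * a))) * (2 * b * (2 * b)) ≡⟨ collect a b ⟩
  64 * (a * (b * b))                          ≤⟨ *-monoˡ-≤ (a * (b * b)) (m≤m+n 64 17) ⟩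
  81 * (a * (b * b))                          ≤⟨ *-monoʳ-≤ 81 (2^i*4^j≤3^i j r) ⟩
  81 * c                                      ≡⟨ spread c ⟩
  3 * (3 * (3 * (3 * c)))                     ∎
  where
  a = 2 ^ (j * 4 + r)
  b = 2 ^ j
  c = 3 ^ (j * 4 + r)
  collect : ∀ a b → 2 * (2 * (2 * (2 * a))) * (2 * b * (2 * b)) ≡ 64 * (a * (b * b))
  collect = solve-∀
  spread : ∀ c → 81 * c ≡ 3 * (3 * (3 * (3 * c)))
  spread = solve-∀

f-floorTwoThirdsPow≤ : ∀ n j r → f (floorTwoThirdsPow (j * 4 + r) n) ≤ 6 * ⌊ ceilSqrt n /2^ j ⌋
f-floorTwoThirdsPow≤ n j r = begin
  f y                               ≤⟨ f≤3*ceilSqrt y ⟩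
  3 * ceilSqrt y                    ≤⟨ *-monoʳ-≤ 3 (<[1+h]²⇒ceilSqrt≤2h h y<[1+h]²) ⟩
  3 * (2 * h)                       ≡⟨ *-assoc 3 2 h ⟨
  6 * h                             ∎
  where
  i = j * 4 + r
  y = floorTwoThirdsPow i n
  b = 2 ^ j
  m = ceilSqrt n
  h = ⌊ m /2^ j ⌋
  y*4^j≤n : y * (b * b) ≤ n
  y*4^j≤n = *-cancelʳ-≤ _ _ (3 ^ i) {{m^n≢0 3 i}} (begin
    y * (b * b) * 3 ^ i             ≡⟨ swap-last y (b * b) (3 ^ i) ⟩
    y * 3 ^ i * (b * b)             ≤⟨ *-monoˡ-≤ (b * b) (floorTwoThirdsPow-spec i n) ⟩
    2 ^ i * n * (b * b)             ≡⟨ rotate (2 ^ i) n (b * b) ⟩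
    n * (2 ^ i * (b * b))           ≤⟨ *-monoʳ-≤ n (2^i*4^j≤3^i j r) ⟩
    n * 3 ^ i                       ∎)
    where
    swap-last : ∀ x y z → x * y * z ≡ x * z * y
    swap-last = solve-∀
    rotate : ∀ x y z → x * y * z ≡ y * (x * z)
    rotate = solve-∀
  y<[1+h]² : y < suc h * suc h
  y<[1+h]² = <-of-scaled-squares {b = b} {h = h} (≤-trans y*4^j≤n (≤ceilSqrt² n)) (m<[1+⌊m/2^j⌋]*2^j m j)

C-f≤51*ceilSqrt : ∀ n → C-f n ≤ 51 * ceilSqrt n
C-f≤51*ceilSqrt n = begin
  f n + sum (map t (upTo N))
    ≡⟨ cong (λ s → f n + sum s) (map-upTo t N) ⟩
  f n + sum (applyUpTo t N)
    ≤⟨ +-mono-≤ (f≤3*ceilSqrt n) (sum-applyUpTo-monoʳ t (m≤m*n N 4)) ⟩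
  3 * m + sum (applyUpTo t (N * 4))
    ≤⟨ +-monoʳ-≤ (3 * m) (sum-applyUpTo-blocks N t u (λ j r _ → f-floorTwoThirdsPow≤ n j r)) ⟩
  3 * m + 4 * sum (applyUpTo u N)
    ≡⟨ cong (λ s → 3 * m + 4 * s) (sum-applyUpTo-*ˡ 6 (λ j → ⌊ m /2^ j ⌋) N) ⟩
  3 * m + 4 * (6 * sum (applyUpTo (λ j → ⌊ m /2^ j ⌋) N))
    ≤⟨ +-monoʳ-≤ (3 * m) (*-monoʳ-≤ 4 (*-monoʳ-≤ 6 (sum-⌊m/2^j⌋≤2*m N m))) ⟩
  3 * m + 4 * (6 * (2 * m))
    ≡⟨ collect m ⟩
  51 * m ∎
  where
  m = ceilSqrt n
  N = ceilLog32 n + 2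
  t = λ i → f (floorTwoThirdsPow i n)
  u = λ j → 6 * ⌊ m /2^ j ⌋
  collect : ∀ a → 3 * a + 4 * (6 * (2 * a)) ≡ 51 * a
  collect = solve-∀

-- Separations

x∈p─q⇒x∉q : ∀ {n} {x : Fin n} {p q : Subset n} → x ∈ p ─ q → x ∉ q
x∈p─q⇒x∉q {p = inside ∷ p} {outside ∷ q} here      ()
x∈p─q⇒x∉q {p = _ ∷ p}      {_ ∷ q}       (there x∈) (there x∈q) = x∈p─q⇒x∉q x∈ x∈q

∣p∪q∣+∣p∩q∣≡∣p∣+∣q∣ : ∀ {n} (p q : Subset n) → ∣ p ∪ q ∣ + ∣ p ∩ q ∣ ≡ ∣ p ∣ + ∣ q ∣
∣p∪q∣+∣p∩q∣≡∣p∣+∣q∣ []           []           = refl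
∣p∪q∣+∣p∩q∣≡∣p∣+∣q∣ (inside ∷ p)  (inside ∷ q)  =
  cong suc (trans (+-suc _ _) (trans (cong suc (∣p∪q∣+∣p∩q∣≡∣p∣+∣q∣ p q)) (sym (+-suc _ _))))
∣p∪q∣+∣p∩q∣≡∣p∣+∣q∣ (inside ∷ p)  (outside ∷ q) = cong suc (∣p∪q∣+∣p∩q∣≡∣p∣+∣q∣ p q)
∣p∪q∣+∣p∩q∣≡∣p∣+∣q∣ (outside ∷ p) (inside ∷ q)  =
  trans (cong suc (∣p∪q∣+∣p∩q∣≡∣p∣+∣q∣ p q)) (sym (+-suc _ _))
∣p∪q∣+∣p∩q∣≡∣p∣+∣q∣ (outside ∷ p) (outside ∷ q) = ∣p∪q∣+∣p∩q∣≡∣p∣+∣q∣ p q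

∣p∣+∣q∣≤∣p∪q∣ : ∀ {n} (p q : Subset n) → p ∩ q ≡ ⊥ → ∣ p ∣ + ∣ q ∣ ≤ ∣ p ∪ q ∣
∣p∣+∣q∣≤∣p∪q∣ {n} p q p∩q≡⊥ = begin
  ∣ p ∣ + ∣ q ∣                     ≡⟨ ∣p∪q∣+∣p∩q∣≡∣p∣+∣q∣ p q ⟨
  ∣ p ∪ q ∣ + ∣ p ∩ q ∣             ≡⟨ cong (λ r → ∣ p ∪ q ∣ + ∣ r ∣) p∩q≡⊥ ⟩
  ∣ p ∪ q ∣ + ∣ ⊥ {n} ∣             ≡⟨ cong (∣ p ∪ q ∣ +_) (∣⊥∣≡0 n) ⟩
  ∣ p ∪ q ∣ + 0                     ≡⟨ +-identityʳ _ ⟩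
  ∣ p ∪ q ∣                         ∎

Adj-sym : ∀ {n} (G : Graph n) {u v} → Adj G u v → Adj G v u
Adj-sym G {u} {v} = subst T (adj-sym G u v)

Disjoint : ∀ {n} → Subset n → Subset n → Set
Disjoint p q = ∀ {x} → x ∈ p → x ∉ q

record Splits {n} (G : Graph n) (U A B C : Subset n) : Set where
  field
    A⊆U     : A ⊆ U
    B⊆U     : B ⊆ U
    C⊆U     : C ⊆ U
    cover   : ∀ {x} → x ∈ U → x ∈ A ⊎ x ∈ B ⊎ x ∈ C
    A∩C≡∅   : Disjoint A C
    B∩C≡∅   : Disjoint B C
    no-edge : ∀ {a b} → a ∈ A → b ∈ B → ¬ Adj G a b

Splits-swap : ∀ {n} {G : Graph n} {U A B C} → Splits G U A B C → Splits G U B A C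
Splits-swap {G = G} {U} {A} {B} {C} s = record
  { A⊆U = B⊆U ; B⊆U = A⊆U ; C⊆U = C⊆U ; cover = cover′ ; A∩C≡∅ = B∩C≡∅ ; B∩C≡∅ = A∩C≡∅
  ; no-edge = λ b∈B a∈A → no-edge a∈A b∈B ∘ Adj-sym G }
  where
  open Splits s
  cover′ : ∀ {x} → x ∈ U → x ∈ B ⊎ x ∈ A ⊎ x ∈ C
  cover′ x∈U with cover x∈U
  ... | inj₁ x∈A        = inj₂ (inj₁ x∈A)
  ... | inj₂ (inj₁ x∈B) = inj₁ x∈B
  ... | inj₂ (inj₂ x∈C) = inj₂ (inj₂ x∈C)

separation-splits : ∀ {n} {G : Graph n} {U A B C} → IsSeparation G U (A , B , C) → Splits G U A B C
separation-splits {U = U} {A} {B} {C} (A∪B∪C≡U , _ , A∩C≡⊥ , B∩C≡⊥ , no-edge , _) = record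
  { A⊆U = into-U ∘ x∈p∪q⁺ ∘ inj₁ ∘ x∈p∪q⁺ ∘ inj₁
  ; B⊆U = into-U ∘ x∈p∪q⁺ ∘ inj₁ ∘ x∈p∪q⁺ ∘ inj₂
  ; C⊆U = into-U ∘ x∈p∪q⁺ ∘ inj₂
  ; cover = cover
  ; A∩C≡∅ = λ x∈A x∈C → ∉⊥ (subst (_ ∈_) A∩C≡⊥ (x∈p∩q⁺ (x∈A , x∈C)))
  ; B∩C≡∅ = λ x∈B x∈C → ∉⊥ (subst (_ ∈_) B∩C≡⊥ (x∈p∩q⁺ (x∈B , x∈C)))
  ; no-edge = λ a∈A b∈B → no-edge _ _ a∈A b∈B }
  where
  into-U : (A ∪ B) ∪ C ⊆ U
  into-U = subst (_ ∈_) A∪B∪C≡U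
  cover : ∀ {x} → x ∈ U → x ∈ A ⊎ x ∈ B ⊎ x ∈ C
  cover {x} x∈U with x∈p∪q⁻ (A ∪ B) C (subst (x ∈_) (sym A∪B∪C≡U) x∈U)
  ... | inj₂ x∈C = inj₂ (inj₂ x∈C)
  ... | inj₁ x∈A∪B with x∈p∪q⁻ A B x∈A∪B
  ...   | inj₁ x∈A = inj₁ x∈A
  ...   | inj₂ x∈B = inj₂ (inj₁ x∈B)

separation-parts : ∀ {n} {G : Graph n} {U A B C} → IsSeparation G U (A , B , C) →
                   ∣ A ∣ + ∣ B ∣ ≤ ∣ U ∣
separation-parts {A = A} {B} {C} (A∪B∪C≡U , A∩B≡⊥ , _) =
  ≤-trans (∣p∣+∣q∣≤∣p∪q∣ A B A∩B≡⊥)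
          (subst (λ U → ∣ A ∪ B ∣ ≤ ∣ U ∣) A∪B∪C≡U (∣p∣≤∣p∪q∣ (A ∪ B) C))

Guards : ∀ {n} → Graph n → Subset n → Subset n → Set
Guards G W A = ∀ {x y} → x ∉ A → Adj G x y → y ∈ A → x ∈ W

guards-part : ∀ {n} {G : Graph n} {U A B C H} → Splits G U A B C → Guards G H U → Guards G (H ∪ C) A
guards-part {U = U} s H-guards-U {x} x∉A x~y y∈A with x ∈? U
... | no  x∉U = x∈p∪q⁺ (inj₁ (H-guards-U x∉U x~y (A⊆U y∈A)))
  where open Splits s
... | yes x∈U with Splits.cover s x∈U
...   | inj₁ x∈A        = contradiction x∈A x∉A
...   | inj₂ (inj₁ x∈B) = contradiction x~y (Splits.no-edge (Splits-swap s) x∈B y∈A)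
...   | inj₂ (inj₂ x∈C) = x∈p∪q⁺ (inj₂ x∈C)

separation-sizes : ∀ {n} {G : Graph n} {U A B C} → IsSeparation G U (A , B , C) →
                   3 * ∣ A ∣ ≤ 2 * ∣ U ∣ × 3 * ∣ B ∣ ≤ 2 * ∣ U ∣ × ∣ C ∣ * ∣ C ∣ ≤ 8 * ∣ U ∣
separation-sizes (_ , _ , _ , _ , _ , sizes) = sizes

-- Duration

++-reassoc : ∀ {a} {A : Set a} (xs ys zs ws : List A) →
             (xs ++ (ys ++ zs)) ++ ws ≡ xs ++ (ys ++ (zs ++ ws))
++-reassoc xs ys zs ws = trans (++-assoc xs (ys ++ zs) ws) (cong (xs ++_) (++-assoc ys zs ws))

places : ∀ {n} → List (Op n) → ℕ
places []               = 0
places (place _ ∷ ops)  = suc (places ops)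
places (remove _ ∷ ops) = places ops

places-++ : ∀ {n} (xs ys : List (Op n)) → places (xs ++ ys) ≡ places xs + places ys
places-++ []               ys = refl
places-++ (place _ ∷ xs)  ys = cong suc (places-++ xs ys)
places-++ (remove _ ∷ xs) ys = places-++ xs ys

module _ {n k} {G : Graph n} {σ : CopStrategy G k} {D : ℕ} where

  runs-duration : ∀ {held t ops t′} → Runs σ D held t ops t′ → t′ ≤ t + D * places ops
  runs-duration {t = t} done = m≤m+n t _
  runs-duration {t = t} {place _ ∷ ops} (place d d≤D _ _ rest) = begin
    _                               ≤⟨ runs-duration rest ⟩
    t + d + D * places ops          ≤⟨ +-monoˡ-≤ _ (+-monoʳ-≤ t d≤D) ⟩
    t + D + D * places ops          ≡⟨ +-assoc t D _ ⟩
    t + (D + D * places ops)        ≡⟨ cong (t +_) (*-suc D (places ops)) ⟨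
    t + D * suc (places ops)        ∎
  runs-duration (remove rest) = runs-duration rest

  Runs-remove⁻ : ∀ {held t X ops t′} → Runs σ D held t (remove X ∷ ops) t′ → Runs σ D (held ─ X) t ops t′
  Runs-remove⁻ (remove rest) = rest

⊔+⊔≤ : ∀ {p q p′ q′ z} → p + p′ ≤ z → p + q′ ≤ z → q + p′ ≤ z → q + q′ ≤ z → (p ⊔ q) + (p′ ⊔ q′) ≤ z
⊔+⊔≤ {p} {q} {p′} {q′} pp′ pq′ qp′ qq′ = begin
  (p ⊔ q) + (p′ ⊔ q′)                         ≡⟨ +-distribʳ-⊔ (p′ ⊔ q′) p q ⟩
  (p + (p′ ⊔ q′)) ⊔ (q + (p′ ⊔ q′))           ≡⟨ cong₂ _⊔_ (+-distribˡ-⊔ p p′ q′) (+-distribˡ-⊔ q p′ q′) ⟩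
  ((p + p′) ⊔ (p + q′)) ⊔ ((q + p′) ⊔ (q + q′)) ≤⟨ ⊔-lub (⊔-lub pp′ pq′) (⊔-lub qp′ qq′) ⟩
  _                                           ∎

parts-places-bound : ∀ {thr u a b} → thr ≤ u → 3 * a ≤ 2 * u → 3 * b ≤ 2 * u → a + b ≤ u →
                     (2 * thr ⊔ 6 * a) + (2 * thr ⊔ 6 * b) ≤ 6 * u
parts-places-bound {thr} {u} {a} {b} thr≤u 3a≤2u 3b≤2u a+b≤u = ⊔+⊔≤ {2 * thr} {6 * a} {2 * thr} {6 * b}
  (≤-trans (+-mono-≤ 2thr≤2u (≤-trans 2thr≤2u (*-monoˡ-≤ u (m≤m+n 2 2)))) 2u+4u≤6u)
  (≤-trans (+-mono-≤ 2thr≤2u (6x≤4u b 3b≤2u)) 2u+4u≤6u)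
  (≤-trans (+-mono-≤ (6x≤4u a 3a≤2u) 2thr≤2u) (≤-reflexive (sym (*-distribʳ-+ u 4 2))))
  (≤-trans (≤-reflexive (sym (*-distribˡ-+ 6 a b))) (*-monoʳ-≤ 6 a+b≤u))
  where
  2thr≤2u : 2 * thr ≤ 2 * u
  2thr≤2u = *-monoʳ-≤ 2 thr≤u
  6x≤4u : ∀ x → 3 * x ≤ 2 * u → 6 * x ≤ 4 * u
  6x≤4u x 3x≤2u = begin
    6 * x       ≡⟨ *-assoc 2 3 x ⟩
    2 * (3 * x) ≤⟨ *-monoʳ-≤ 2 3x≤2u ⟩
    2 * (2 * u) ≡⟨ *-assoc 2 2 u ⟨
    4 * u       ∎
  2u+4u≤6u : 2 * u + 4 * u ≤ 6 * u
  2u+4u≤6u = ≤-reflexive (sym (*-distribʳ-+ u 2 4))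

module _ {n} {G : Graph n} {𝒮 : Separator n} (sep : IsLTSeparator G 𝒮) (thr : ℕ) where

  stt-places : ∀ fuel U → suc (places (sttOps 𝒮 thr fuel U)) * thr ≤ 2 * thr ⊔ 6 * ∣ U ∣
  stt-places zero       U = m≤m⊔n (2 * thr) _
  stt-places (suc fuel) U with ∣ U ∣ ≤? thr
  ... | yes _    = m≤m⊔n (2 * thr) _
  ... | no U≰thr = ≤-trans (begin
    suc (suc (places (opsA ++ (opsB ++ remove C ∷ [])))) * thr
                                        ≡⟨ cong (λ p → suc (suc p) * thr) places-children ⟩
    suc (suc (pA + (pB + 0))) * thr     ≡⟨ distribute pA pB thr ⟩
    suc pA * thr + suc pB * thr         ≤⟨ +-mono-≤ (stt-places fuel A) (stt-places fuel B) ⟩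
    (2 * thr ⊔ 6 * ∣ A ∣) + (2 * thr ⊔ 6 * ∣ B ∣)
                                        ≤⟨ parts-places-bound {a = ∣ A ∣} (<⇒≤ (≰⇒> U≰thr)) 3A≤2U 3B≤2U
                                             (separation-parts {G = G} (sep U)) ⟩
    6 * ∣ U ∣                           ∎) (m≤n⊔m (2 * thr) _)
    where
    A = proj₁ (𝒮 U)
    B = proj₁ (proj₂ (𝒮 U))
    C = proj₂ (proj₂ (𝒮 U))
    opsA = sttOps 𝒮 thr fuel A
    opsB = sttOps 𝒮 thr fuel B
    pA = places opsA
    pB = places opsB
    3A≤2U = proj₁ (separation-sizes {G = G} (sep U))
    3B≤2U = proj₁ (proj₂ (separation-sizes {G = G} (sep U)))
    places-children : places (opsA ++ (opsB ++ remove C ∷ [])) ≡ pA + (pB + 0)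
    places-children = trans (places-++ opsA _) (cong (pA +_) (places-++ opsB _))
    distribute : ∀ a b t → suc (suc (a + (b + 0))) * t ≡ suc a * t + suc b * t
    distribute = solve-∀

f-pos : ∀ {n} → 1 ≤ n → 0 < f n
f-pos {n} 1≤n = ceilSqrt-pos (≤-trans 1≤n (m≤m+n n (7 * n)))

stt-places-≤ : ∀ {n} {G : Graph n} {𝒮 : Separator n} → 1 ≤ n → IsLTSeparator G 𝒮 →
               places (STT 𝒮) ≤ 6 * ceilSqrt n
stt-places-≤ {n} {G} {𝒮} 1≤n sep = *-cancelʳ-≤ P (6 * m) (f n) {{>-nonZero (f-pos 1≤n)}} (begin
  P * f n                           ≤⟨ m≤n+m (P * f n) (f n) ⟩
  suc P * f n                       ≤⟨ stt-places {G = G} sep (f n) (suc n) ⊤ ⟩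
  2 * f n ⊔ 6 * ∣ ⊤ {n} ∣           ≤⟨ ⊔-lub (*-monoˡ-≤ (f n) 2≤6m) 6∣⊤∣≤6m*fn ⟩
  6 * m * f n                       ∎)
  where
  P = places (STT 𝒮)
  m = ceilSqrt n
  2≤6m : 2 ≤ 6 * m
  2≤6m = ≤-trans (m≤m+n 2 4) (*-monoʳ-≤ 6 (ceilSqrt-pos 1≤n))
  6∣⊤∣≤6m*fn : 6 * ∣ ⊤ {n} ∣ ≤ 6 * m * f n
  6∣⊤∣≤6m*fn = begin
    6 * ∣ ⊤ {n} ∣                   ≡⟨ cong (6 *_) (∣⊤∣≡n n) ⟩
    6 * n                           ≤⟨ *-monoʳ-≤ 6 (≤ceilSqrt² n) ⟩
    6 * (m * m)                     ≤⟨ *-monoʳ-≤ 6 (*-monoʳ-≤ m (ceilSqrt≤f n)) ⟩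
    6 * (m * f n)                   ≡⟨ *-assoc 6 m (f n) ⟨
    6 * m * f n                     ∎

stt-duration : ∀ {n k} {G : Graph n} {σ : CopStrategy G k} {D 𝒮 t′} → 1 ≤ n → IsLTSeparator G 𝒮 →
               RealisesSTT σ D 𝒮 t′ → t′ ≤ 51 * D * ceilSqrt n
stt-duration {n} {G = G} {D = D} {𝒮} {t′} 1≤n sep realisation = begin
  t′                                ≤⟨ runs-duration realisation ⟩
  D * places (STT 𝒮)                ≤⟨ *-monoʳ-≤ D (stt-places-≤ {G = G} 1≤n sep) ⟩
  D * (6 * m)                       ≤⟨ *-monoʳ-≤ D (*-monoˡ-≤ m (m≤m+n 6 45)) ⟩
  D * (51 * m)                      ≡⟨ rearrange D m ⟩
  51 * D * m                        ∎
  where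
  m = ceilSqrt n
  rearrange : ∀ a b → a * (51 * b) ≡ 51 * a * b
  rearrange = solve-∀

-- Capture

caughtWithin-mono : ∀ {n k} {G : Graph n} {σ : CopStrategy G k} {r : RobberWalk G} {a b} →
                    a ≤ b → CaughtWithin σ r a → CaughtWithin σ r b
caughtWithin-mono a≤b (t , t≤a , i , inj₁ caught)         = t , ≤-trans t≤a a≤b , i , inj₁ caught
caughtWithin-mono a≤b (t , t≤a , i , inj₂ (t<a , caught)) =
  t , ≤-trans t≤a a≤b , i , inj₂ (≤-trans t<a a≤b , caught)

module Capture {n k} {G : Graph n} (σ : CopStrategy G k) (r : RobberWalk G) where

  OccupiedDuring : Subset n → ℕ → ℕ → Set
  OccupiedDuring X a b = ∀ s → a ≤ s → s ≤ b → Occupied σ s X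

  Cleared : Subset n → ℕ → Set
  Cleared U t = CaughtWithin σ r t ⊎ rob r t ∉ U

  occupied-⊆ : ∀ {X Y s} → Y ⊆ X → Occupied σ s X → Occupied σ s Y
  occupied-⊆ Y⊆X occ x x∈Y = occ x (Y⊆X x∈Y)

  during-⊆ : ∀ {X Y a b} → Y ⊆ X → OccupiedDuring X a b → OccupiedDuring Y a b
  during-⊆ Y⊆X occ s a≤s s≤b = occupied-⊆ Y⊆X (occ s a≤s s≤b)

  during-join : ∀ {X a b c} → OccupiedDuring X a b → OccupiedDuring X b c → OccupiedDuring X a c
  during-join {b = b} occ₁ occ₂ s a≤s s≤c with s ≤? b
  ... | yes s≤b = occ₁ s a≤s s≤b
  ... | no  s≰b = occ₂ s (<⇒≤ (≰⇒> s≰b)) s≤c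

  caught-on : ∀ {X s t} → s ≤ t → Occupied σ s X → rob r s ∈ X → CaughtWithin σ r t
  caught-on s≤t occ r∈X = let (i , on-robber) = occ _ r∈X in _ , s≤t , i , inj₁ on-robber

  occupied-cleared : ∀ {U t} → Occupied σ t U → Cleared U t
  occupied-cleared {U} {t} occ with rob r t ∈? U
  ... | yes r∈U = inj₁ (caught-on ≤-refl occ r∈U)
  ... | no  r∉U = inj₂ r∉U

  stays-cleared : ∀ {W A a b} → Guards G W A → a ≤ b → OccupiedDuring W a b → Cleared A a → Cleared A b
  stays-cleared {W} {A} {a} W-guards-A a≤b = go (≤⇒≤′ a≤b)
    where
    go : ∀ {b} → a ≤′ b → OccupiedDuring W a b → Cleared A a → Cleared A b
    go ≤′-refl _ cleared = cleared
    go (≤′-step {b} a≤′b) occ cleared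
      with go a≤′b (λ s a≤s s≤b → occ s a≤s (m≤n⇒m≤1+n s≤b)) cleared
    ... | inj₁ caught = inj₁ (caughtWithin-mono {σ = σ} {r} (n≤1+n b) caught)
    ... | inj₂ r∉A with rob r (suc b) ∈? A | legal r b
    ...   | no  r′∉A | _           = inj₂ r′∉A
    ...   | yes r′∈A | inj₁ stayed = contradiction (subst (_∈ A) (sym stayed) r′∈A) r∉A
    ...   | yes r′∈A | inj₂ moved  =
      inj₁ (caught-on (n≤1+n b) (occ b (≤′⇒≤ a≤′b) (n≤1+n b)) (W-guards-A r∉A moved r′∈A))

  parts-cleared : ∀ {U A B C t} → Splits G U A B C → Cleared A t → Cleared B t → Occupied σ t C → Cleared U t
  parts-cleared _ (inj₁ caught) _             _    = inj₁ caught
  parts-cleared _ _             (inj₁ caught) _    = inj₁ caught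
  parts-cleared {U} {t = t} s (inj₂ r∉A) (inj₂ r∉B) occC with rob r t ∈? U
  ... | no  r∉U = inj₂ r∉U
  ... | yes r∈U with Splits.cover s r∈U
  ...   | inj₁ r∈A        = contradiction r∈A r∉A
  ...   | inj₂ (inj₁ r∈B) = contradiction r∈B r∉B
  ...   | inj₂ (inj₂ r∈C) = inj₁ (caught-on ≤-refl occC r∈C)

  module _ (D : ℕ) where

    record Processed (U H : Subset n) (t : ℕ) (ops : List (Op n)) (t′ : ℕ) : Set where
      field
        finish  : ℕ
        held    : Subset n
        started : t ≤ finish
        keeps   : H ⊆ held
        guarded : OccupiedDuring H t finish
        cleared : Cleared U finish
        rest    : Runs σ D held finish ops t′

    Clears : Subset n → List (Op n) → Set
    Clears U opsU = ∀ {H held t ops t′} → H ⊆ held → Disjoint H U → Guards G H U →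
                    Runs σ D held t (opsU ++ ops) t′ → Processed U H t ops t′

    leaf-clears : ∀ {U} → Clears U (place U ∷ remove U ∷ [])
    leaf-clears {U} {H} {held} {t} H⊆held H∌U _ (place d _ occ occU (remove rest)) = record
      { finish  = t + d
      ; held    = (held ∪ U) ─ U
      ; started = m≤m+n t d
      ; keeps   = λ x∈H → x∈p∧x∉q⇒x∈p─q (x∈p∪q⁺ (inj₁ (H⊆held x∈H))) (H∌U x∈H)
      ; guarded = during-⊆ H⊆held occ
      ; cleared = occupied-cleared occU
      ; rest    = rest
      }

    split-clears : ∀ {U A B C opsA opsB} → Splits G U A B C → Clears A opsA → Clears B opsB →
                   Clears U (place C ∷ (opsA ++ (opsB ++ remove C ∷ [])))
    split-clears {U} {A} {B} {C} {opsA} {opsB} s clearsA clearsB {H} {held} {t} {ops}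
                 H⊆held H∌U H-guards-U (place d _ occ _ rest) = record
      { finish  = finish pB
      ; held    = Processed.held pB ─ C
      ; started = ≤-trans (m≤m+n t d) (≤-trans (started pA) (started pB))
      ; keeps   = λ x∈H → x∈p∧x∉q⇒x∈p─q (keeps pB (x∈p∪q⁺ (inj₁ x∈H))) (H∌U x∈H ∘ C⊆U)
      ; guarded = during-join (during-⊆ H⊆held occ)
                    (during-join (during-⊆ H⊆W (guarded pA)) (during-⊆ H⊆W (guarded pB)))
      ; cleared = parts-cleared s
                    (stays-cleared W-guards-A (started pB) (guarded pB) (cleared pA))
                    (cleared pB)
                    (occupied-⊆ C⊆W (guarded pB (finish pB) (started pB) ≤-refl))
      ; rest    = Runs-remove⁻ (Processed.rest pB)
      }
      where
      open Splits s
      open Processed using (finish; started; keeps; guarded; cleared)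
      W = H ∪ C
      H⊆W : H ⊆ W
      H⊆W = x∈p∪q⁺ ∘ inj₁
      C⊆W : C ⊆ W
      C⊆W = x∈p∪q⁺ ∘ inj₂
      W⊆held∪C : W ⊆ held ∪ C
      W⊆held∪C x∈W with x∈p∪q⁻ H C x∈W
      ... | inj₁ x∈H = x∈p∪q⁺ (inj₁ (H⊆held x∈H))
      ... | inj₂ x∈C = x∈p∪q⁺ (inj₂ x∈C)
      W∌part : ∀ {X} → X ⊆ U → Disjoint X C → Disjoint W X
      W∌part X⊆U X∌C x∈W x∈X with x∈p∪q⁻ H C x∈W
      ... | inj₁ x∈H = H∌U x∈H (X⊆U x∈X)
      ... | inj₂ x∈C = X∌C x∈X x∈C
      W-guards-A : Guards G W A
      W-guards-A = guards-part s H-guards-U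
      pA : Processed A W (t + d) (opsB ++ remove C ∷ ops) _
      pA = clearsA W⊆held∪C (W∌part A⊆U A∩C≡∅) W-guards-A
             (subst (λ o → Runs σ D (held ∪ C) (t + d) o _) (++-reassoc opsA opsB (remove C ∷ []) ops) rest)
      pB : Processed B W (finish pA) (remove C ∷ ops) _
      pB = clearsB (keeps pA) (W∌part B⊆U B∩C≡∅) (guards-part (Splits-swap s) H-guards-U) (Processed.rest pA)

  stt-clears : ∀ {𝒮 : Separator n} → IsLTSeparator G 𝒮 → ∀ thr D fuel U → Clears D U (sttOps 𝒮 thr fuel U)
  stt-clears sep thr D zero       U = leaf-clears D
  stt-clears sep thr D (suc fuel) U with ∣ U ∣ ≤? thr
  ... | yes _ = leaf-clears D
  ... | no  _ = split-clears D (separation-splits (sep U))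
                  (stt-clears sep thr D fuel _) (stt-clears sep thr D fuel _)

stt-captures : ∀ {n k} {G : Graph n} {σ : CopStrategy G k} {D 𝒮 t′} → IsLTSeparator G 𝒮 →
               RealisesSTT σ D 𝒮 t′ → CapturesWithin σ t′
stt-captures {n} {σ = σ} {D} {𝒮} {t′} sep realisation r
  with Capture.stt-clears σ r sep (f n) D (suc n) ⊤ {H = ⊥} id (λ x∈⊥ _ → ∉⊥ x∈⊥)
         (λ x∉⊤ _ _ → contradiction ∈⊤ x∉⊤)
         (subst (λ ops → Runs σ D ⊥ 0 ops t′) (sym (++-identityʳ _)) realisation)
... | record { cleared = inj₁ caught ; rest = done } = caught
... | record { cleared = inj₂ r∉⊤ } = contradiction ∈⊤ r∉⊤

-- Realising STT by walking cops

module _ {n} {G : Graph n} where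

  position : ∀ {t u v} → WithinDist G t u v → ℕ → Fin n
  position {u = u} here       _       = u
  position {u = u} (step _ _) zero    = u
  position         (step _ w) (suc s) = position w s

  position-start : ∀ {t u v} (w : WithinDist G t u v) → position w 0 ≡ u
  position-start here       = refl
  position-start (step _ _) = refl

  position-step : ∀ {t u v} (w : WithinDist G t u v) s → StayOrMove G (position w s) (position w (suc s))
  position-step here                   _       = inj₁ refl
  position-step {u = u} (step u~w w) zero    = inj₂ (subst (Adj G u) (sym (position-start w)) u~w)
  position-step (step _ w)             (suc s) = position-step w s

  position-end : ∀ {t u v} (w : WithinDist G t u v) {s} → t ≤ s → position w s ≡ v
  position-end here       _         = refl
  position-end (step _ w) (s≤s t≤s) = position-end w t≤s

module WalkingCops {n} {G : Graph n} {D} (within : ∀ u v → WithinDist G D u v) (k : ℕ) where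

  route : ∀ u v → WithinDist G D u v
  route u v with u Fin.≟ v
  ... | yes refl = here
  ... | no  _    = within u v

  route-stays : ∀ u s → position (route u u) s ≡ u
  route-stays u s with u Fin.≟ u
  ... | yes refl = refl
  ... | no  u≢u  = contradiction refl u≢u

  Config : Set
  Config = Fin k → Fin n

  -- Rounds eD, …, (e+1)D form phase e, in which every cop walks from its vertex in one
  -- configuration to its vertex in the next along a walk of length at most D.
  walkThrough : Config → List Config → ℕ → Config
  walkThrough c []        t = c
  walkThrough c (c′ ∷ cs) t with t ≤? D
  ... | yes _ = λ i → position (route (c i) (c′ i)) t
  ... | no  _ = walkThrough c′ cs (t ∸ D)

  walkThrough-start : ∀ c cs i → walkThrough c cs 0 i ≡ c i
  walkThrough-start c []        i = refl
  walkThrough-start c (c′ ∷ cs) i with 0 ≤? D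
  ... | yes _  = position-start (route (c i) (c′ i))
  ... | no 0≰D = contradiction z≤n 0≰D

  walkThrough-head : ∀ c c′ cs i {s} → s ≤ D → walkThrough c (c′ ∷ cs) s i ≡ position (route (c i) (c′ i)) s
  walkThrough-head c c′ cs i {s} s≤D with s ≤? D
  ... | yes _  = refl
  ... | no s≰D = contradiction s≤D s≰D

  walkThrough-tail : ∀ c c′ cs i t → walkThrough c (c′ ∷ cs) (D + t) i ≡ walkThrough c′ cs t i
  walkThrough-tail c c′ cs i t with D + t ≤? D
  ... | no  _      = cong (λ s → walkThrough c′ cs s i) (m+n∸m≡n D t)
  ... | yes D+t≤D with n≤0⇒n≡0 (+-cancelˡ-≤ D t 0 (≤-trans D+t≤D (≤-reflexive (sym (+-identityʳ D)))))
  ...   | refl = trans (position-end (route (c i) (c′ i)) (m≤m+n D 0)) (sym (walkThrough-start c′ cs i))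

  walkThrough-step : ∀ c cs t i → StayOrMove G (walkThrough c cs t i) (walkThrough c cs (suc t) i)
  walkThrough-step c []        t i = inj₁ refl
  walkThrough-step c (c′ ∷ cs) t i with t ≤? D | suc t ≤? D
  ... | yes _   | yes _     = position-step (route (c i) (c′ i)) t
  ... | no t≰D  | yes t<D   = contradiction (<⇒≤ t<D) t≰D
  ... | no t≰D  | no  _     = subst (λ s → StayOrMove G (walkThrough c′ cs (t ∸ D) i) (walkThrough c′ cs s i))
                                    (sym (+-∸-assoc 1 (<⇒≤ (≰⇒> t≰D))))
                                    (walkThrough-step c′ cs (t ∸ D) i)
  ... | yes t≤D | no  1+t≰D = subst₂ (λ u s → StayOrMove G u (walkThrough c′ cs s i))
                                    arrived (sym (+-∸-assoc 1 D≤t))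
                                    (walkThrough-step c′ cs (t ∸ D) i)
    where
    D≤t : D ≤ t
    D≤t = ≤-pred (≰⇒> 1+t≰D)
    arrived : walkThrough c′ cs (t ∸ D) i ≡ position (route (c i) (c′ i)) t
    arrived = trans (cong (λ s → walkThrough c′ cs s i) (m≤n⇒m∸n≡0 t≤D))
                (trans (walkThrough-start c′ cs i) (sym (position-end (route (c i) (c′ i)) D≤t)))

  walkingStrategy : Config → List Config → CopStrategy G k
  walkingStrategy c cs = record { cop = walkThrough c cs ; legal = walkThrough-step c cs }

  data Schedule : Config → Subset n → List Config → List (Op n) → Set where
    done   : ∀ {c held} → Schedule c held [] []
    place  : ∀ {c held c′ X cs ops} →
             (∀ {x} → x ∈ held → ∃[ i ] (c i ≡ x × c′ i ≡ x)) →
             (∀ {x} → x ∈ X → ∃[ i ] c′ i ≡ x) →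
             Schedule c′ (held ∪ X) cs ops → Schedule c held (c′ ∷ cs) (place X ∷ ops)
    remove : ∀ {c held X cs ops} → Schedule c (held ─ X) cs ops → Schedule c held cs (remove X ∷ ops)

  schedule-runs : ∀ {σ : CopStrategy G k} {c held cs ops t₀} → Schedule c held cs ops →
                  (∀ t i → cop σ (t₀ + t) i ≡ walkThrough c cs t i) →
                  Runs σ D held t₀ ops (t₀ + length cs * D)
  schedule-runs {σ} {t₀ = t₀} done _ = subst (Runs σ D _ t₀ []) (sym (+-identityʳ t₀)) done
  schedule-runs {σ} {c} {held} {c′ ∷ cs} {t₀ = t₀} (place {X = X} keeps covers next) follows =
    place D ≤-refl held-occupied X-occupied
      (subst (Runs σ D _ (t₀ + D) _) (+-assoc t₀ D (length cs * D)) (schedule-runs next follows-next))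
    where
    at-phase : ∀ {s} → t₀ ≤ s → s ≤ t₀ + D → ∀ i → cop σ s i ≡ position (route (c i) (c′ i)) (s ∸ t₀)
    at-phase {s} t₀≤s s≤t₀+D i =
      trans (cong (λ s → cop σ s i) (sym (m+[n∸m]≡n t₀≤s)))
            (trans (follows (s ∸ t₀) i) (walkThrough-head c c′ cs i (m≤n+o⇒m∸n≤o s t₀ s≤t₀+D)))
    held-occupied : ∀ s → t₀ ≤ s → s ≤ t₀ + D → Occupied σ s held
    held-occupied s t₀≤s s≤t₀+D x x∈held with keeps x∈held
    ... | i , cᵢ≡x , c′ᵢ≡x = i , trans (at-phase t₀≤s s≤t₀+D i)
                                 (trans (cong₂ (λ u v → position (route u v) (s ∸ t₀)) cᵢ≡x c′ᵢ≡x)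
                                        (route-stays x (s ∸ t₀)))
    X-occupied : Occupied σ (t₀ + D) X
    X-occupied x x∈X with covers x∈X
    ... | i , c′ᵢ≡x = i , trans (at-phase (m≤m+n t₀ D) ≤-refl i)
                            (trans (position-end (route (c i) (c′ i)) (≤-reflexive (sym (m+n∸m≡n t₀ D)))) c′ᵢ≡x)
    follows-next : ∀ t i → cop σ (t₀ + D + t) i ≡ walkThrough c′ cs t i
    follows-next t i = trans (cong (λ s → cop σ s i) (+-assoc t₀ D t))
                             (trans (follows (D + t) i) (walkThrough-tail c c′ cs i t))
  schedule-runs (remove next) follows = remove (schedule-runs next follows)

toList : ∀ {n} → Subset n → List (Fin n)
toList []            = []
toList (inside ∷ p)  = Fin.zero ∷ map Fin.suc (toList p)
toList (outside ∷ p) = map Fin.suc (toList p)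

length-toList : ∀ {n} (p : Subset n) → length (toList p) ≡ ∣ p ∣
length-toList []            = refl
length-toList (inside ∷ p)  = cong suc (trans (length-map Fin.suc (toList p)) (length-toList p))
length-toList (outside ∷ p) = trans (length-map Fin.suc (toList p)) (length-toList p)

∈-toList⁺ : ∀ {n} {x : Fin n} {p} → x ∈ p → x ∈ₗ toList p
∈-toList⁺ {p = inside ∷ p}  here        = Any.here refl
∈-toList⁺ {p = inside ∷ p}  (there x∈p) = Any.there (∈-map⁺ Fin.suc (∈-toList⁺ x∈p))
∈-toList⁺ {p = outside ∷ p} (there x∈p) = ∈-map⁺ Fin.suc (∈-toList⁺ x∈p)

∈-toList⁻ : ∀ {n} {x : Fin n} (p : Subset n) → x ∈ₗ toList p → x ∈ p
∈-toList⁻ (inside ∷ p) (Any.here refl) = here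
∈-toList⁻ (inside ∷ p) (Any.there x∈) with ∈-map⁻ Fin.suc x∈
... | y , y∈ , refl = there (∈-toList⁻ p y∈)
∈-toList⁻ (outside ∷ p) x∈ with ∈-map⁻ Fin.suc x∈
... | y , y∈ , refl = there (∈-toList⁻ p y∈)

length-++-toList : ∀ {n} (L : List (Fin n)) X → length (L ++ toList X) ≡ length L + ∣ X ∣
length-++-toList L X = trans (length-++ L) (cong (length L +_) (length-toList X))

-- The cop layout after each placement of STT: cop i stands on the i-th vertex of the list, the
-- concatenation of the separators on Stack-C followed by the vertex set just placed.
sttLayouts : ∀ {n} → Separator n → ℕ → List (Fin n) → ℕ → Subset n → List (List (Fin n))
sttLayouts 𝒮 thr L zero       U = (L ++ toList U) ∷ []
sttLayouts 𝒮 thr L (suc fuel) U with ∣ U ∣ ≤? thr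
... | yes _ = (L ++ toList U) ∷ []
... | no  _ with 𝒮 U
...   | (A , B , C) = (L ++ toList C) ∷ (sttLayouts 𝒮 thr (L ++ toList C) fuel A ++
                                         sttLayouts 𝒮 thr (L ++ toList C) fuel B)

FitIn : ∀ {a} {A : Set a} → ℕ → List (List A) → Set a
FitIn k = All (λ L → length L ≤ k)

module STTSchedule {n} {G : Graph n} {D} (within : ∀ u v → WithinDist G D u v) (k : ℕ) (v₀ : Fin n)
                   (𝒮 : Separator n) (thr : ℕ) where

  open WalkingCops within k

  -- Cops beyond the end of a layout wait at v₀.
  _!_ : List (Fin n) → ℕ → Fin n
  []      ! _     = v₀
  (x ∷ _) ! zero  = x
  (_ ∷ L) ! suc p = L ! p

  layout : List (Fin n) → Config
  layout L i = L ! toℕ i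

  Extends : Config → List (Fin n) → Set
  Extends c L = ∀ i → toℕ i < length L → c i ≡ layout L i

  _⊆ᴸ_ : Subset n → List (Fin n) → Set
  X ⊆ᴸ L = ∀ {x} → x ∈ X → x ∈ₗ L

  !-++ : ∀ L Y {p} → p < length L → (L ++ Y) ! p ≡ L ! p
  !-++ (x ∷ L) Y {zero}  _         = refl
  !-++ (x ∷ L) Y {suc p} (s≤s p<L) = !-++ L Y p<L

  !-index : ∀ {x} L → x ∈ₗ L → ∃[ p ] (p < length L × L ! p ≡ x)
  !-index (y ∷ L) (Any.here refl) = 0 , s≤s z≤n , refl
  !-index (y ∷ L) (Any.there x∈L) with !-index L x∈L
  ... | p , p<L , L!p≡x = suc p , s≤s p<L , L!p≡x

  layout-extends : ∀ L Y → Extends (layout (L ++ Y)) L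
  layout-extends L Y i i<L = !-++ L Y i<L

  extends-prefix : ∀ {c} L Y → Extends c (L ++ Y) → Extends c L
  extends-prefix L Y c⊒L++Y i i<L =
    trans (c⊒L++Y i (≤-trans i<L (length-++-≤ˡ L))) (!-++ L Y i<L)

  layout-index : ∀ {x} L → length L ≤ k → x ∈ₗ L → ∃[ i ] (toℕ i < length L × layout L i ≡ x)
  layout-index L L≤k x∈L with !-index L x∈L
  ... | p , p<L , L!p≡x = fromℕ< (≤-trans p<L L≤k) ,
                          subst (_< length L) (sym (toℕ-fromℕ< _)) p<L ,
                          trans (cong (L !_) (toℕ-fromℕ< _)) L!p≡x

  kept-in-place : ∀ {c held} L Y → held ⊆ᴸ L → Extends c L → length (L ++ Y) ≤ k →
                  ∀ {x} → x ∈ held → ∃[ i ] (c i ≡ x × layout (L ++ Y) i ≡ x)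
  kept-in-place L Y held⊆L c⊒L L++Y≤k x∈held
    with layout-index L (≤-trans (length-++-≤ˡ L) L++Y≤k) (held⊆L x∈held)
  ... | i , i<L , Lᵢ≡x = i , trans (c⊒L i i<L) Lᵢ≡x , trans (layout-extends L Y i i<L) Lᵢ≡x

  placed-covered : ∀ L X → length (L ++ toList X) ≤ k → ∀ {x} → x ∈ X → ∃[ i ] layout (L ++ toList X) i ≡ x
  placed-covered L X fits x∈X with layout-index (L ++ toList X) fits (∈-++⁺ʳ L (∈-toList⁺ x∈X))
  ... | i , _ , Mᵢ≡x = i , Mᵢ≡x

  Schedules : List (Fin n) → List (List (Fin n)) → List (Op n) → Set
  Schedules L layouts opsU = ∀ {c held cs ops} → held ⊆ᴸ L → Extends c L → FitIn k layouts →
    (∀ {c′ held′} → held′ ⊆ᴸ L → Extends c′ L → Schedule c′ held′ cs ops) →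
    Schedule c held (map layout layouts ++ cs) (opsU ++ ops)

  leaf-schedules : ∀ L U → Schedules L ((L ++ toList U) ∷ []) (place U ∷ remove U ∷ [])
  leaf-schedules L U {held = held} held⊆L c⊒L (fits ∷ []) continue =
    place (kept-in-place L (toList U) held⊆L c⊒L fits) (placed-covered L U fits)
      (remove (continue left⊆L (layout-extends L (toList U))))
    where
    left⊆L : ((held ∪ U) ─ U) ⊆ᴸ L
    left⊆L x∈ with x∈p∪q⁻ held U (p─q⊆p _ U x∈)
    ... | inj₁ x∈held = held⊆L x∈held
    ... | inj₂ x∈U    = contradiction x∈U (x∈p─q⇒x∉q x∈)

  split-schedules : ∀ L C {layoutsA layoutsB opsA opsB} →
                    Schedules (L ++ toList C) layoutsA opsA → Schedules (L ++ toList C) layoutsB opsB →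
                    Schedules L ((L ++ toList C) ∷ (layoutsA ++ layoutsB))
                                (place C ∷ (opsA ++ (opsB ++ remove C ∷ [])))
  split-schedules L C {layoutsA} {layoutsB} {opsA} {opsB} scheduleA scheduleB {held = held} {cs} {ops}
                  held⊆L c⊒L (fits ∷ fitsAB) continue =
    place (kept-in-place L (toList C) held⊆L c⊒L fits) (placed-covered L C fits)
      (subst₂ (Schedule (layout M) (held ∪ C)) layouts-assoc (sym (++-reassoc opsA opsB (remove C ∷ []) ops))
        (scheduleA held∪C⊆M (λ _ _ → refl) (proj₁ (++⁻ layoutsA fitsAB))
          (λ heldA⊆M cA⊒M → scheduleB heldA⊆M cA⊒M (proj₂ (++⁻ layoutsA fitsAB))
            (λ heldB⊆M cB⊒M → remove (continue (removed⊆L heldB⊆M) (extends-prefix L (toList C) cB⊒M))))))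
    where
    M = L ++ toList C
    held∪C⊆M : (held ∪ C) ⊆ᴸ M
    held∪C⊆M x∈ with x∈p∪q⁻ held C x∈
    ... | inj₁ x∈held = ∈-++⁺ˡ (held⊆L x∈held)
    ... | inj₂ x∈C    = ∈-++⁺ʳ L (∈-toList⁺ x∈C)
    removed⊆L : ∀ {held′} → held′ ⊆ᴸ M → (held′ ─ C) ⊆ᴸ L
    removed⊆L held′⊆M x∈ with ∈-++⁻ L (held′⊆M (p─q⊆p _ C x∈))
    ... | inj₁ x∈L = x∈L
    ... | inj₂ x∈C = contradiction (∈-toList⁻ C x∈C) (x∈p─q⇒x∉q x∈)
    layouts-assoc : map layout layoutsA ++ (map layout layoutsB ++ cs) ≡ map layout (layoutsA ++ layoutsB) ++ cs
    layouts-assoc = trans (sym (++-assoc (map layout layoutsA) _ cs))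
                          (cong (_++ cs) (sym (map-++ layout layoutsA layoutsB)))

  stt-schedules : ∀ fuel U L → Schedules L (sttLayouts 𝒮 thr L fuel U) (sttOps 𝒮 thr fuel U)
  stt-schedules zero       U L = leaf-schedules L U
  stt-schedules (suc fuel) U L with ∣ U ∣ ≤? thr
  ... | yes _ = leaf-schedules L U
  ... | no  _ = split-schedules L _ (stt-schedules fuel _ _) (stt-schedules fuel _ _)

  stt-schedule : FitIn k (sttLayouts 𝒮 thr [] (suc n) ⊤) →
                 Schedule (layout []) ⊥ (map layout (sttLayouts 𝒮 thr [] (suc n) ⊤)) (sttOps 𝒮 thr (suc n) ⊤)
  stt-schedule fits = subst₂ (Schedule (layout []) ⊥) (++-identityʳ _) (++-identityʳ _)
    (stt-schedules (suc n) ⊤ [] (λ x∈⊥ → contradiction x∈⊥ ∉⊥) (λ _ ()) fits (λ _ _ → done))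

-- C_f(n) cops suffice

module Capacity {n} {G : Graph n} {𝒮 : Separator n} (sep : IsLTSeparator G 𝒮) (1≤n : 1 ≤ n) where

  g : ℕ → ℕ
  g i = f (floorTwoThirdsPow i n)

  budget-≤ : ∀ {j} → j ≤ ceilLog32 n + 2 → sum (applyUpTo g j) + f n ≤ C-f n
  budget-≤ {j} j≤ = begin
    sum (applyUpTo g j) + f n                     ≡⟨ +-comm _ (f n) ⟩
    f n + sum (applyUpTo g j)                     ≤⟨ +-monoʳ-≤ (f n) (sum-applyUpTo-monoʳ g j≤) ⟩
    f n + sum (applyUpTo g (ceilLog32 n + 2))     ≡⟨ cong (λ s → f n + sum s) (map-upTo g (ceilLog32 n + 2)) ⟨
    C-f n                                         ∎

  AtDepth : ℕ → Subset n → Set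
  AtDepth j U = ∣ U ∣ * 3 ^ j ≤ 2 ^ j * n

  depth-≤ : ∀ {j U} → AtDepth j U → ∣ U ∣ ≤ floorTwoThirdsPow j n
  depth-≤ {j} {U} atDepth =
    subst (_≤ floorTwoThirdsPow j n) (m*n/n≡m ∣ U ∣ (3 ^ j) {{m^n≢0 3 j}})
          (/-monoˡ-≤ (3 ^ j) {{m^n≢0 3 j}} atDepth)

  separator-fits : ∀ {j U} {C : Subset n} → AtDepth j U → ∣ C ∣ * ∣ C ∣ ≤ 8 * ∣ U ∣ → ∣ C ∣ ≤ g j
  separator-fits {j} {U} atDepth C²≤8U = ≤ceilSqrt (≤-trans C²≤8U (*-monoʳ-≤ 8 (depth-≤ {j} {U} atDepth)))

  part-deeper : ∀ {j U X} → AtDepth j U → 3 * ∣ X ∣ ≤ 2 * ∣ U ∣ → AtDepth (suc j) X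
  part-deeper {j} {U} {X} atDepth 3X≤2U = begin
    ∣ X ∣ * (3 * 3 ^ j)           ≡⟨ rotate ∣ X ∣ 3 (3 ^ j) ⟩
    3 * ∣ X ∣ * 3 ^ j             ≤⟨ *-monoˡ-≤ (3 ^ j) 3X≤2U ⟩
    2 * ∣ U ∣ * 3 ^ j             ≡⟨ *-assoc 2 ∣ U ∣ (3 ^ j) ⟩
    2 * (∣ U ∣ * 3 ^ j)           ≤⟨ *-monoʳ-≤ 2 atDepth ⟩
    2 * (2 ^ j * n)               ≡⟨ *-assoc 2 (2 ^ j) n ⟨
    2 * 2 ^ j * n                 ∎
    where
    rotate : ∀ a b c → a * (b * c) ≡ b * a * c
    rotate = solve-∀

  shallow : ∀ {j U} → AtDepth j U → f n < ∣ U ∣ → j < ceilLog32 n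
  shallow {j} {U} atDepth f<U with j <? ceilLog32 n
  ... | yes j<lg = j<lg
  ... | no  j≮lg = contradiction U≤1 (<⇒≱ (≤-trans (s≤s (f-pos 1≤n)) f<U))
    where
    U≤1 : ∣ U ∣ ≤ 1
    U≤1 = *-cancelʳ-≤ ∣ U ∣ 1 (3 ^ j) {{m^n≢0 3 j}} (begin
      ∣ U ∣ * 3 ^ j               ≤⟨ atDepth ⟩
      2 ^ j * n                   ≡⟨ *-comm (2 ^ j) n ⟩
      n * 2 ^ j                   ≤⟨ *2^≤3^-mono {n} (ceilLog32-spec n) (≮⇒≥ j≮lg) ⟩
      3 ^ j                       ≡⟨ *-identityˡ (3 ^ j) ⟨
      1 * 3 ^ j                   ∎)

  -- The fuel bound ensures that the recursion does not stop before depth ⌈log_{3/2} n⌉, from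
  -- which on every part has at most one vertex.
  layouts-fit : ∀ fuel U L j → j ≤ ceilLog32 n → ceilLog32 n < j + fuel → AtDepth j U →
                length L ≤ sum (applyUpTo g j) → FitIn (C-f n) (sttLayouts 𝒮 (f n) L fuel U)
  layouts-fit zero U L j j≤lg lg<j+0 _ _ = contradiction (subst (_ <_) (+-identityʳ j) lg<j+0) (≤⇒≯ j≤lg)
  layouts-fit (suc fuel) U L j j≤lg lg<j+fuel atDepth L≤budget with ∣ U ∣ ≤? f n
  ... | yes U≤f = (begin
    length (L ++ toList U)        ≡⟨ length-++-toList L U ⟩
    length L + ∣ U ∣              ≤⟨ +-mono-≤ L≤budget U≤f ⟩
    sum (applyUpTo g j) + f n     ≤⟨ budget-≤ (≤-trans j≤lg (m≤m+n _ 2)) ⟩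
    C-f n                         ∎) ∷ []
  ... | no  U≰f = (begin
    length M                      ≤⟨ M≤budget ⟩
    sum (applyUpTo g (suc j))     ≤⟨ m≤m+n _ (f n) ⟩
    sum (applyUpTo g (suc j)) + f n ≤⟨ budget-≤ (≤-trans j<lg (m≤m+n _ 2)) ⟩
    C-f n                         ∎) ∷
    ++⁺ (layouts-fit fuel A M (suc j) j<lg lg<1+j+fuel (part-deeper {j} {U} {A} atDepth 3A≤2U) M≤budget)
        (layouts-fit fuel B M (suc j) j<lg lg<1+j+fuel (part-deeper {j} {U} {B} atDepth 3B≤2U) M≤budget)
    where
    A = proj₁ (𝒮 U)
    B = proj₁ (proj₂ (𝒮 U))
    C = proj₂ (proj₂ (𝒮 U))
    M = L ++ toList C
    sizes = separation-sizes {G = G} (sep U)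
    3A≤2U = proj₁ sizes
    3B≤2U = proj₁ (proj₂ sizes)
    j<lg : j < ceilLog32 n
    j<lg = shallow {j} {U} atDepth (≰⇒> U≰f)
    lg<1+j+fuel : ceilLog32 n < suc j + fuel
    lg<1+j+fuel = subst (ceilLog32 n <_) (+-suc j fuel) lg<j+fuel
    M≤budget : length M ≤ sum (applyUpTo g (suc j))
    M≤budget = begin
      length M                    ≡⟨ length-++-toList L C ⟩
      length L + ∣ C ∣            ≤⟨ +-mono-≤ L≤budget (separator-fits {j} {U} {C} atDepth (proj₂ (proj₂ sizes))) ⟩
      sum (applyUpTo g j) + g j   ≡⟨ sum-applyUpTo-suc g j ⟨
      sum (applyUpTo g (suc j))   ∎

  stt-layouts-fit : FitIn (C-f n) (sttLayouts 𝒮 (f n) [] (suc n) ⊤)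
  stt-layouts-fit = layouts-fit (suc n) ⊤ [] 0 z≤n (s≤s (ceilLog32-≤ n)) ⊤-at-root z≤n
    where
    ⊤-at-root : AtDepth 0 ⊤
    ⊤-at-root = ≤-reflexive (trans (*-identityʳ _) (trans (∣⊤∣≡n n) (sym (*-identityˡ n))))

stt-realisable : ∀ {n} {G : Graph n} {D 𝒮} → 1 ≤ n → (∀ u v → WithinDist G D u v) → IsLTSeparator G 𝒮 →
                 Σ (CopStrategy G (C-f n)) λ σ → ∃[ t′ ] RealisesSTT σ D 𝒮 t′
stt-realisable {n} {G} {D} {𝒮} 1≤n within sep =
  walkingStrategy (layout []) (map layout (sttLayouts 𝒮 (f n) [] (suc n) ⊤)) , _ ,
  schedule-runs (stt-schedule (Capacity.stt-layouts-fit {G = G} sep 1≤n)) (λ _ _ → refl)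
  where
  open WalkingCops within (C-f n)
  open STTSchedule within (C-f n) (fromℕ< 1≤n) 𝒮 (f n)

corollary2 : Σ ℕ λ c →
    ∀ (n : ℕ) (G : Graph n) (D : ℕ) (𝒮 : Separator n) →
    1 ≤ n → Planar G → IsDiameter G D → IsLTSeparator G 𝒮 →
    -- k = C_f(n) = O(√n)
    C-f n ≤ c * ceilSqrt n ×
    -- STT with k = C_f(n) cops can be carried out on G
    (Σ (CopStrategy G (C-f n)) λ σ → ∃[ t' ] RealisesSTT σ D 𝒮 t') ×
    -- every realisation of STT captures the robber within O(D·√n) rounds
    (∀ (σ : CopStrategy G (C-f n)) (t' : ℕ) → RealisesSTT σ D 𝒮 t' →
       t' ≤ c * D * ceilSqrt n × CapturesWithin σ t') ×
    -- in particular capt_k(G) = O(D·√n)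
    CaptLe G (C-f n) (c * D * ceilSqrt n)
corollary2 = 51 , λ n G D 𝒮 1≤n _ diameter sep →
  -- Planarity enters only through the Lipton–Tarjan separator 𝒮.
  let (σ , t′ , realisation) = stt-realisable 1≤n (proj₁ diameter) sep in
  C-f≤51*ceilSqrt n ,
  (σ , t′ , realisation) ,
  (λ _ _ realisation′ → stt-duration 1≤n sep realisation′ , stt-captures sep realisation′) ,
  (σ , λ r → caughtWithin-mono {σ = σ} {r} (stt-duration 1≤n sep realisation)
                                             (stt-captures sep realisation r))
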